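{- Let $\varphi_1,\varphi_2$ be CNFs and $B_1,B_2$ OBDDs with $\varphi_1\unlhd B_1$ and $\varphi_2\unlhd B_2$. Suppose that for some $k_1,k_2\ge0$, every inner node $q_1$ of $B_1$ satisfies $|\mathsf{Path^f}(q_1)|-\tau(q_1,\varphi_1)\le k_1$ and every inner node $q_2$ of $B_2$ satisfies $|\mathsf{Path^f}(q_2)|-\tau(q_2,\varphi_2)\le k_2$. Then the conjunction algorithm returns an OBDD $B_1\wedge B_2$ such that every inner node $q$ of $B_1\wedge B_2$ satisfies $|\mathsf{Path^f}(q)|-\tau(q,\varphi_1\wedge\varphi_2)\le k_1+k_2$.
   Context: A literal is a variable or its negation, a clause a disjunction of literals, a CNF a conjunction of clauses; $\mathsf{Cls}(\varphi)$ is the set of clauses of $\varphi$. An OBDD is a directed acyclic graph with a unique root, in which every inner node $p$ is labelled by a variable $\mathsf{var}(p)$ and has a true-successor and a false-successor, every leaf is labelled $\mathsf{true}$ or $\mathsf{false}$, and there is a fixed total order $\prec$ of variables (common to all OBDDs) such that along every edge between inner nodes labelled $x$ then $y$ we have $x\prec y$. A path of an OBDD $B$ is the sequence of literals $l_1\dots l_k$ read along a walk from the root to a leaf through inner nodes $p_1,\dots,p_k$, with $l_i=\mathsf{var}(p_i)$ if the walk goes to the true-successor of $p_i$ and $l_i=\lnot\mathsf{var}(p_i)$ otherwise. $\mathsf{Path^f}(B)$ is the set of paths ending at the $\mathsf{false}$ leaf, and $\mathsf{Path^f}(q)$ those whose walk passes through node $q$. For a path $\alpha$ and clause $C$, $\alpha\not\models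 C$ means every assignment satisfying all literals of $\alpha$ falsifies $C$. $\varphi\unlhd B$ means: an assignment falsifies $\varphi$ iff it satisfies all literals of some $\alpha\in\mathsf{Path^f}(B)$; and for every $\alpha\in\mathsf{Path^f}(B)$ there is $C\in\mathsf{Cls}(\varphi)$ with $\alpha\not\models C$. Whenever $\varphi\unlhd B$, a function $F:\mathsf{Path^f}(B)\to\mathsf{Cls}(\varphi)$ with $\alpha\not\models F(\alpha)$ for all $\alpha$ is (tacitly) fixed, and $\mathsf{Cls}(q,\varphi)=\{F(\alpha)\mid\alpha\in\mathsf{Path^f}(q)\}$, $\gamma(q,C)=|\{\alpha\in\mathsf{Path^f}(q)\mid F(\alpha)=C\}|-1$, $\tau(q,\varphi)=\sum_{C\in\mathsf{Cls}(q,\varphi)}\gamma(q,C)$. Conjunction $B_1\wedge B_2$ is computed recursively: if $B_1$ or $B_2$ is the $\mathsf{false}$ leaf return $\mathsf{false}$; if $B_1$ is $\mathsf{true}$ return $B_2$; if $B_2$ is $\mathsf{true}$ return $B_1$; otherwise let $x,y$ be the root variables; if $x=y$ return a node labelled $x$ with true-child $\mathsf{high}(B_1)\wedge\mathsf{high}(B_2)$ and false-child $\mathsf{low}(B_1)\wedge\mathsf{low}(B_2)$; if $x\prec y$ return a node labelled $x$ with children $\mathsf{high}(B_1)\wedge B_2$, $\mathsf{low}(B_1)\wedge B_2$; if $y\prec x$ symmetrically. Here $\mathsf{high},\mathsf{low}$ denote the sub-OBDDs rooted at the true-/false-successor of the root. Existing identical nodes are reused; no elimination is performed. -}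

module Defs where

open import Data.Nat using (ℕ; _<_; _∸_)
open import Data.Nat.Properties using (<-cmp)
import Data.Nat as N
open import Data.Bool using (Bool; true; false)
import Data.Bool as B
open import Data.Product using (_×_; _,_; Σ)
import Data.Product.Properties as PP
open import Data.List using (List; []; _∷_; _++_; map; length; filter; deduplicate)
open import Data.Nat.ListAction using (sum)
import Data.List.Properties as LP
open import Data.List.Relation.Unary.All using (All)
open import Data.List.Relation.Unary.Any using (Any)
open import Data.List.Membership.Propositional using (_∈_)
open import Data.Unit using (⊤)
open import Data.Empty using (⊥)
open import Relation.Nullary using (¬_; yes; no)
open import Relation.Binary using (DecidableEquality; tri<; tri≈; tri>)
open import Relation.Binary.PropositionalEquality using (_≡_; refl; cong)
open import Function.Bundles using (_⇔_)

-- Variables, literals, clauses, CNFs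
-- Variables are natural numbers; the fixed total order ≺ is _<_ on ℕ.
-- A literal (x , true) is x, (x , false) is ¬x.

Var : Set
Var = ℕ

Lit : Set
Lit = Var × Bool

Clause : Set
Clause = List Lit

CNF : Set
CNF = List Clause          -- Cls(φ) = the clauses listed (membership _∈_)

Assignment : Set
Assignment = Var → Bool

LitSat : Assignment → Lit → Set
LitSat a (x , b) = a x ≡ b

ClauseSat : Assignment → Clause → Set
ClauseSat a C = Any (LitSat a) C

CNFSat : Assignment → CNF → Set
CNFSat a φ = All (ClauseSat a) φ

_∧ᶜ_ : CNF → CNF → CNF
φ ∧ᶜ ψ = φ ++ ψ

-- Identical nodes are always shared (unique table), so a node is
-- determined by its label and its children; hence an OBDD is represented
-- by the tree it unfolds to and a node of an OBDD by a sub-OBDD.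

data BDD : Set where
  leaf : Bool → BDD
  node : Var → BDD → BDD → BDD     -- node x high low

Above : Var → BDD → Set
Above x (leaf _)     = ⊤
Above x (node y _ _) = x < y

Ordered : BDD → Set
Ordered (leaf _)     = ⊤
Ordered (node x h l) = Above x h × Above x l × Ordered h × Ordered l

data _⊑_ : BDD → BDD → Set where
  here : ∀ {b} → b ⊑ b
  inH  : ∀ {q x h l} → q ⊑ h → q ⊑ node x h l
  inL  : ∀ {q x h l} → q ⊑ l → q ⊑ node x h l

IsInner : BDD → Set
IsInner (leaf _)     = ⊥
IsInner (node _ _ _) = ⊤

_≟B_ : DecidableEquality BDD
leaf a ≟B leaf b with a B.≟ b
... | yes refl = yes refl
... | no ne = no λ { refl → ne refl }
leaf _ ≟B node _ _ _ = no λ ()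
node _ _ _ ≟B leaf _ = no λ ()
node x h l ≟B node y h' l' with x N.≟ y | h ≟B h' | l ≟B l'
... | yes refl | yes refl | yes refl = yes refl
... | no ne | _ | _ = no λ { refl → ne refl }
... | yes _ | no ne | _ = no λ { refl → ne refl }
... | yes _ | yes _ | no ne = no λ { refl → ne refl }

Path : Set
Path = List Lit

fpaths : BDD → List Path
fpaths (leaf true)  = []
fpaths (leaf false) = [] ∷ []
fpaths (node x h l) = map ((x , true) ∷_) (fpaths h) ++ map ((x , false) ∷_) (fpaths l)

-- Path^f(q) in B: false paths of B whose walk passes through node q
fpathsVia : BDD → BDD → List Path
fpathsVia q b with b ≟B q
fpathsVia q b | yes _ = fpaths b
fpathsVia q (leaf _) | no _ = []
fpathsVia q (node x h l) | no _ =
  map ((x , true) ∷_) (fpathsVia q h) ++ map ((x , false) ∷_) (fpathsVia q l)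

_⊭_ : Path → Clause → Set
α ⊭ C = ∀ (a : Assignment) → All (LitSat a) α → ¬ ClauseSat a C

Represents : CNF → BDD → Set
Represents φ B = ∀ (a : Assignment) →
  (¬ CNFSat a φ) ⇔ Any (All (LitSat a)) (fpaths B)

ValidF : CNF → BDD → (Path → Clause) → Set
ValidF φ B F = ∀ α → α ∈ fpaths B → (F α ∈ φ) × (α ⊭ F α)

_⊴_ : CNF → BDD → Set
φ ⊴ B = Represents φ B × Σ (Path → Clause) (ValidF φ B)

_≟C_ : DecidableEquality Clause
_≟C_ = LP.≡-dec (PP.≡-dec N._≟_ B._≟_)

ClsAt : (Path → Clause) → BDD → BDD → List Clause
ClsAt F B q = deduplicate _≟C_ (map F (fpathsVia q B))

γ : (Path → Clause) → BDD → BDD → Clause → ℕ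
γ F B q C = length (filter (λ α → F α ≟C C) (fpathsVia q B)) ∸ 1

τ : (Path → Clause) → BDD → BDD → ℕ
τ F B q = sum (map (γ F B q) (ClsAt F B q))

excess : (Path → Clause) → BDD → BDD → ℕ
excess F B q = length (fpathsVia q B) ∸ τ F B q

data Cmp : Set where
  lt eq gt : Cmp

cmpV : Var → Var → Cmp
cmpV x y with <-cmp x y
... | tri< _ _ _ = lt
... | tri≈ _ _ _ = eq
... | tri> _ _ _ = gt

-- (conjR x h₁ l₁ b₂ is the case B₁ = node x h₁ l₁ ∧ b₂; it only splits
-- the recursion into structural steps, the algorithm is the one above.)
_∧B_ : BDD → BDD → BDD
conjR : Var → BDD → BDD → BDD → BDD

leaf false ∧B b = leaf false
leaf true  ∧B b = b
node x h₁ l₁ ∧B b = conjR x h₁ l₁ b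

conjR x h₁ l₁ (leaf false) = leaf false
conjR x h₁ l₁ (leaf true)  = node x h₁ l₁
conjR x h₁ l₁ (node y h₂ l₂) with cmpV x y
... | lt = node x (h₁ ∧B node y h₂ l₂) (l₁ ∧B node y h₂ l₂)
... | eq = node x (h₁ ∧B h₂) (l₁ ∧B l₂)
... | gt = node y (conjR x h₁ l₁ h₂) (conjR x h₁ l₁ l₂)

-- Since τ(q,φ) = Σ_C (|{α ∈ Path^f(q) | F(α) = C}| - 1), the quantity |Path^f(q)| - τ(q,φ) is
-- just |Cls(q,φ)|, the number of distinct clauses F assigns to the false paths through q; the
-- hypotheses at the roots thus say |Cls(B₁,φ₁)| ≤ k₁ and |Cls(B₂,φ₂)| ≤ k₂.  Every false path α
-- of B₁ ∧ B₂ contains all literals of a false path β of B₁ or of B₂ (the algorithm follows B₁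
-- and B₂ simultaneously until one of them reaches false), so α falsifies the clause assigned to
-- β, and we let F(α) be that clause.  Then every Cls(q, φ₁ ∧ φ₂) lies in
-- Cls(B₁,φ₁) ∪ Cls(B₂,φ₂), which has at most k₁ + k₂ elements.  (If B₁ or B₂ is the false
-- leaf, so is B₁ ∧ B₂, and there is no inner node to check.)
module Submission where

open import Defs
open import Algebra.Properties.CommutativeSemigroup using (interchange)
open import Data.Bool using (Bool; true; false; _∧_; if_then_else_)
open import Data.Bool.Properties using (∧-zeroʳ; ∧-identityʳ)
open import Data.Empty using (⊥-elim)
open import Data.List using (List; []; _∷_; _++_; map; length; filter; deduplicate)
open import Data.List.Membership.Propositional using (_∈_; _∉_; find; lose)
open import Data.List.Membership.Propositional.Properties
  using (∈-map⁺; ∈-map⁻; ∈-++⁺ˡ; ∈-++⁺ʳ; ∈-++⁻; ∈-filter⁺; ∈-deduplicate⁺; ∈-deduplicate⁻)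
import Data.List.Properties as List
open import Data.List.Relation.Binary.Subset.Propositional using (_⊆_)
open import Data.List.Relation.Binary.Subset.Propositional.Properties
  using (⊆-refl; ⊆-trans; xs⊆x∷xs; ∷⁺ʳ; All-resp-⊇)
import Data.List.Relation.Binary.Subset.Propositional.Properties as Subset
open import Data.List.Relation.Unary.All as All using (All; _∷_)
open import Data.List.Relation.Unary.All.Properties using (++⁺; ++⁻ˡ; ++⁻ʳ)
open import Data.List.Relation.Unary.Any as Any using (Any; here; there; any?)
import Data.List.Relation.Unary.Any.Properties as AnyP
open import Data.List.Relation.Unary.Unique.Propositional using (Unique; _∷_)
open import Data.List.Relation.Unary.Unique.DecPropositional.Properties using (deduplicate-!)
open import Data.Nat using (ℕ; suc; _+_; _∸_; _≤_; _<_; z≤n; s≤s)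
open import Data.Nat.ListAction using (sum)
open import Data.Nat.Properties
  using (<-cmp; ≤-trans; +-mono-≤; +-suc; +-assoc; +-comm; m∸n+n≡m; m+n∸m≡n; +-commutativeSemigroup;
         module ≤-Reasoning)
import Data.Bool
import Data.Nat
open import Data.Product.Properties using (≡-dec)
open import Data.Product using (_×_; _,_; ∃; Σ)
import Data.Product as Product
open import Data.Sum using (_⊎_; inj₁; inj₂; [_,_])
import Data.Sum as Sum
open import Data.Unit using (tt)
open import Function.Bundles using (_⇔_; mk⇔; Equivalence)
open import Function.Construct.Composition using (_⇔-∘_)
open import Function.Construct.Symmetry using (⇔-sym)
open import Relation.Binary using (DecidableEquality; tri<; tri≈; tri>)
open import Relation.Binary.PropositionalEquality
  using (_≡_; _≢_; refl; sym; trans; cong; cong₂; subst; module ≡-Reasoning)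
open import Relation.Nullary using (¬_; Dec; yes; no; ¬?; map′)
open import Relation.Unary using (Decidable)

module Multiplicity {A : Set} (_≟_ : DecidableEquality A) where

  Unique∧⊆⇒length≤ : ∀ {u v : List A} → Unique u → u ⊆ v → length u ≤ length v
  Unique∧⊆⇒length≤ {[]} _ _ = z≤n
  Unique∧⊆⇒length≤ {x ∷ u} {v} (x∉u ∷ u!) x∷u⊆v = begin
    suc (length u)                 ≤⟨ s≤s (Unique∧⊆⇒length≤ u! u⊆v-x) ⟩
    suc (length (filter x≢? v))    ≤⟨ List.filter-notAll x≢? v x∈v ⟩
    length v                       ∎
    where
    open ≤-Reasoning
    x≢? : Decidable (x ≢_)
    x≢? z = ¬? (x ≟ z)
    x∈v : Any (λ z → ¬ x ≢ z) v
    x∈v = Any.map (λ { refl x≢x → x≢x refl }) (x∷u⊆v (here refl))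
    u⊆v-x : u ⊆ filter x≢? v
    u⊆v-x z∈u = ∈-filter⁺ x≢? (x∷u⊆v (there z∈u)) (All.lookup x∉u z∈u)

  multiplicity : {P : Set} → (P → A) → List P → A → ℕ
  multiplicity f xs c = length (filter (λ x → f x ≟ c) xs)

  distinct : {P : Set} → (P → A) → List P → List A
  distinct f xs = deduplicate _≟_ (map f xs)

  indicator : A → A → ℕ
  indicator a c with a ≟ c
  ... | yes _ = 1
  ... | no _ = 0

  multiplicity-∷ : ∀ {P : Set} (f : P → A) x xs c →
                   multiplicity f (x ∷ xs) c ≡ indicator (f x) c + multiplicity f xs c
  multiplicity-∷ f x xs c with f x ≟ c
  ... | yes _ = refl
  ... | no _ = refl

  sum-indicator-∉ : ∀ {a} D → a ∉ D → sum (map (indicator a) D) ≡ 0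
  sum-indicator-∉ [] _ = refl
  sum-indicator-∉ {a} (d ∷ D) a∉ with a ≟ d
  ... | yes refl = ⊥-elim (a∉ (here refl))
  ... | no _ = sum-indicator-∉ D (λ a∈ → a∉ (there a∈))

  sum-indicator-∈ : ∀ {a D} → Unique D → a ∈ D → sum (map (indicator a) D) ≡ 1
  sum-indicator-∈ {a} {d ∷ D} (d∉D ∷ D!) a∈ with a ≟ d
  sum-indicator-∈ {D = d ∷ D} (d∉D ∷ D!) a∈ | yes refl =
    cong suc (sum-indicator-∉ D (λ d∈ → All.lookup d∉D d∈ refl))
  sum-indicator-∈ (d∉D ∷ D!) (here refl) | no a≢d = ⊥-elim (a≢d refl)
  sum-indicator-∈ (d∉D ∷ D!) (there a∈) | no _ = sum-indicator-∈ D! a∈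

  sum-map-+ : ∀ (g h : A → ℕ) D → sum (map (λ c → g c + h c) D) ≡ sum (map g D) + sum (map h D)
  sum-map-+ g h [] = refl
  sum-map-+ g h (d ∷ D) rewrite sum-map-+ g h D =
    interchange +-commutativeSemigroup (g d) (h d) (sum (map g D)) (sum (map h D))

  sum-multiplicity : ∀ {P : Set} (f : P → A) {D} → Unique D → ∀ xs → map f xs ⊆ D →
                     sum (map (multiplicity f xs) D) ≡ length xs
  sum-multiplicity f {D} D! [] _ = sum-map-zero D
    where
    sum-map-zero : ∀ D → sum (map (multiplicity f []) D) ≡ 0
    sum-map-zero [] = refl
    sum-map-zero (_ ∷ D) = sum-map-zero D
  sum-multiplicity f {D} D! (x ∷ xs) fx∷xs⊆D = begin
    sum (map (multiplicity f (x ∷ xs)) D)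
      ≡⟨ cong sum (List.map-cong (multiplicity-∷ f x xs) D) ⟩
    sum (map (λ c → indicator (f x) c + multiplicity f xs c) D)
      ≡⟨ sum-map-+ (indicator (f x)) (multiplicity f xs) D ⟩
    sum (map (indicator (f x)) D) + sum (map (multiplicity f xs) D)
      ≡⟨ cong₂ _+_ (sum-indicator-∈ D! (fx∷xs⊆D (here refl)))
                   (sum-multiplicity f D! xs (λ fxs → fx∷xs⊆D (there fxs))) ⟩
    suc (length xs) ∎
    where open ≡-Reasoning

  sum-map-pred : ∀ (g : A → ℕ) D → (∀ {c} → c ∈ D → 1 ≤ g c) →
                 sum (map (λ c → g c ∸ 1) D) + length D ≡ sum (map g D)
  sum-map-pred g [] _ = refl
  sum-map-pred g (d ∷ D) g≥1 = begin
    g d ∸ 1 + S′ + suc (length D)   ≡⟨ +-suc (g d ∸ 1 + S′) (length D) ⟩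
    suc (g d ∸ 1 + S′ + length D)   ≡⟨ cong suc (+-assoc (g d ∸ 1) S′ (length D)) ⟩
    suc (g d ∸ 1 + (S′ + length D)) ≡⟨ cong (λ s → suc (g d ∸ 1 + s)) (sum-map-pred g D (λ c∈ → g≥1 (there c∈))) ⟩
    suc (g d ∸ 1) + sum (map g D)   ≡⟨ cong (_+ sum (map g D)) (trans (+-comm 1 (g d ∸ 1)) (m∸n+n≡m (g≥1 (here refl)))) ⟩
    g d + sum (map g D)             ∎
    where
    open ≡-Reasoning
    S′ : ℕ
    S′ = sum (map (λ c → g c ∸ 1) D)

  length∸surplus≡#distinct : ∀ {P : Set} (f : P → A) xs →
    length xs ∸ sum (map (λ c → multiplicity f xs c ∸ 1) (distinct f xs)) ≡ length (distinct f xs)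
  length∸surplus≡#distinct f xs = begin
    length xs ∸ surplus                                     ≡⟨ cong (_∸ surplus) (sym Σmultiplicity) ⟩
    surplus + length (distinct f xs) ∸ surplus              ≡⟨ m+n∸m≡n surplus (length (distinct f xs)) ⟩
    length (distinct f xs)                                  ∎
    where
    open ≡-Reasoning
    surplus : ℕ
    surplus = sum (map (λ c → multiplicity f xs c ∸ 1) (distinct f xs))
    Σmultiplicity : surplus + length (distinct f xs) ≡ length xs
    Σmultiplicity = trans
      (sum-map-pred (multiplicity f xs) (distinct f xs)
        (λ c∈ → List.filter-some (λ x → f x ≟ _)
          (Any.map sym (AnyP.map⁻ (∈-deduplicate⁻ _≟_ (map f xs) c∈)))))
      (sum-multiplicity f (deduplicate-! _≟_ (map f xs)) xs (∈-deduplicate⁺ _≟_))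

data CmpView (x y : Var) : Cmp → Set where
  less    : x < y → CmpView x y lt
  equal   : x ≡ y → CmpView x y eq
  greater : y < x → CmpView x y gt

cmpView : ∀ x y → CmpView x y (cmpV x y)
cmpView x y with <-cmp x y
... | tri< x<y _ _ = less x<y
... | tri≈ _ x≡y _ = equal x≡y
... | tri> _ _ y<x = greater y<x

conjR-above : ∀ z x h l B → z < x → Above z B → Above z (conjR x h l B)
conjR-above z x h l (leaf false) _ _ = tt
conjR-above z x h l (leaf true) z<x _ = z<x
conjR-above z x h l (node y _ _) z<x z<y with cmpV x y
... | lt = z<x
... | eq = z<x
... | gt = z<y

∧B-above : ∀ z B₁ B₂ → Above z B₁ → Above z B₂ → Above z (B₁ ∧B B₂)
∧B-above z (leaf false) B₂ _ _ = tt
∧B-above z (leaf true) B₂ _ z<B₂ = z<B₂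
∧B-above z (node x h l) B₂ z<x z<B₂ = conjR-above z x h l B₂ z<x z<B₂

∧B-ordered : ∀ B₁ B₂ → Ordered B₁ → Ordered B₂ → Ordered (B₁ ∧B B₂)
conjR-ordered : ∀ x h l B → Ordered (node x h l) → Ordered B → Ordered (conjR x h l B)

∧B-ordered (leaf false) B₂ _ _ = tt
∧B-ordered (leaf true) B₂ _ o₂ = o₂
∧B-ordered (node x h l) B₂ o₁ o₂ = conjR-ordered x h l B₂ o₁ o₂

conjR-ordered x h l (leaf false) _ _ = tt
conjR-ordered x h l (leaf true) o _ = o
conjR-ordered x h l B@(node y h₂ l₂) o@(x<h , x<l , oh , ol) oB@(y<h₂ , y<l₂ , oh₂ , ol₂)
  with cmpV x y | cmpView x y
... | lt | less x<y =
  ∧B-above x h B x<h x<y , ∧B-above x l B x<l x<y , ∧B-ordered h B oh oB , ∧B-ordered l B ol oB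
... | eq | equal refl =
  ∧B-above x h h₂ x<h y<h₂ , ∧B-above x l l₂ x<l y<l₂ , ∧B-ordered h h₂ oh oh₂ , ∧B-ordered l l₂ ol ol₂
... | gt | greater y<x =
  conjR-above y x h l h₂ y<x y<h₂ , conjR-above y x h l l₂ y<x y<l₂ ,
  conjR-ordered x h l h₂ o oh₂ , conjR-ordered x h l l₂ o ol₂

data NodePath (x : Var) (h l : BDD) : Path → Set where
  high : ∀ {α} → α ∈ fpaths h → NodePath x h l ((x , true) ∷ α)
  low  : ∀ {α} → α ∈ fpaths l → NodePath x h l ((x , false) ∷ α)

fpaths-node⁻ : ∀ x h l {α} → α ∈ fpaths (node x h l) → NodePath x h l α
fpaths-node⁻ x h l α∈ with ∈-++⁻ (map ((x , true) ∷_) (fpaths h)) α∈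
... | inj₁ α∈h with ∈-map⁻ ((x , true) ∷_) α∈h
...   | _ , α′∈ , refl = high α′∈
fpaths-node⁻ x h l α∈ | inj₂ α∈l with ∈-map⁻ ((_ , false) ∷_) α∈l
...   | _ , α′∈ , refl = low α′∈

fpaths-high : ∀ {x} h l {α} → α ∈ fpaths h → (x , true) ∷ α ∈ fpaths (node x h l)
fpaths-high _ _ α∈ = ∈-++⁺ˡ (∈-map⁺ _ α∈)

fpaths-low : ∀ {x} h l {α} → α ∈ fpaths l → (x , false) ∷ α ∈ fpaths (node x h l)
fpaths-low {x} h _ α∈ = ∈-++⁺ʳ (map ((x , true) ∷_) (fpaths h)) (∈-map⁺ _ α∈)

eval : Assignment → BDD → Bool
eval a (leaf b) = b
eval a (node x h l) = if a x then eval a h else eval a l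

fpath⇒eval≡false : ∀ {a} B {α} → α ∈ fpaths B → All (LitSat a) α → eval a B ≡ false
fpath⇒eval≡false (leaf false) _ _ = refl
fpath⇒eval≡false (node x h l) α∈ α-sat with fpaths-node⁻ x h l α∈ | α-sat
... | high α′∈ | ax ∷ α′-sat rewrite ax = fpath⇒eval≡false h α′∈ α′-sat
... | low α′∈ | ax ∷ α′-sat rewrite ax = fpath⇒eval≡false l α′∈ α′-sat

eval≡false⇒fpath : ∀ {a} B → eval a B ≡ false → ∃ λ α → α ∈ fpaths B × All (LitSat a) α
eval≡false⇒fpath (leaf false) _ = [] , here refl , All.[]
eval≡false⇒fpath {a} (node x h l) B≡false with a x in ax
... | true  = let α , α∈ , α-sat = eval≡false⇒fpath h B≡false in _ , fpaths-high h l α∈ , ax ∷ α-sat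
... | false = let α , α∈ , α-sat = eval≡false⇒fpath l B≡false in _ , fpaths-low h l α∈ , ax ∷ α-sat

eval≡false⇔fpath : ∀ a B → eval a B ≡ false ⇔ Any (All (LitSat a)) (fpaths B)
eval≡false⇔fpath a B = mk⇔
  (λ B≡false → let _ , α∈ , α-sat = eval≡false⇒fpath B B≡false in lose α∈ α-sat)
  (λ sat → let _ , α∈ , α-sat = find sat in fpath⇒eval≡false B α∈ α-sat)

eval-∧B : ∀ a B₁ B₂ → eval a (B₁ ∧B B₂) ≡ eval a B₁ ∧ eval a B₂
eval-conjR : ∀ a x h l B → eval a (conjR x h l B) ≡ eval a (node x h l) ∧ eval a B

eval-∧B a (leaf false) B₂ = refl
eval-∧B a (leaf true) B₂ = refl
eval-∧B a (node x h l) B₂ = eval-conjR a x h l B₂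

eval-conjR a x h l (leaf false) = sym (∧-zeroʳ _)
eval-conjR a x h l (leaf true) = sym (∧-identityʳ _)
eval-conjR a x h l B@(node y h₂ l₂) with cmpV x y | cmpView x y
... | lt | less _ with a x
...   | true  = eval-∧B a h B
...   | false = eval-∧B a l B
eval-conjR a x h l (node y h₂ l₂) | eq | equal refl with a x
...   | true  = eval-∧B a h h₂
...   | false = eval-∧B a l l₂
eval-conjR a x h l (node y h₂ l₂) | gt | greater _ with a y
...   | true  = eval-conjR a x h l h₂
...   | false = eval-conjR a x h l l₂

¬×⇔∧≡false : ∀ {S₁ S₂ : Set} {b₁ b₂} → ((¬ S₁) ⇔ b₁ ≡ false) → ((¬ S₂) ⇔ b₂ ≡ false) →
             (¬ (S₁ × S₂)) ⇔ b₁ ∧ b₂ ≡ false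
¬×⇔∧≡false {b₁ = false} e₁ e₂ = mk⇔ (λ _ → refl) (λ _ (s₁ , _) → Equivalence.from e₁ refl s₁)
¬×⇔∧≡false {b₁ = true} {false} e₁ e₂ = mk⇔ (λ _ → refl) (λ _ (_ , s₂) → Equivalence.from e₂ refl s₂)
¬×⇔∧≡false {b₁ = true} {true} e₁ e₂ = mk⇔ not-both λ ()
  where
  -- with both bits true, S₁ and S₂ are each irrefutable, hence so is S₁ × S₂
  not-both : ¬ (_ × _) → true ≡ false
  not-both ¬s = Equivalence.to e₁ λ s₁ → true≢false (Equivalence.to e₂ λ s₂ → ¬s (s₁ , s₂))
    where
    true≢false : true ≢ false
    true≢false ()

Represents⇔eval : ∀ {φ B} → Represents φ B → ∀ a → (¬ CNFSat a φ) ⇔ eval a B ≡ false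
Represents⇔eval {B = B} r a = ⇔-sym (eval≡false⇔fpath a B) ⇔-∘ r a

Represents-∧ : ∀ {φ₁ φ₂ B₁ B₂} → Represents φ₁ B₁ → Represents φ₂ B₂ →
               Represents (φ₁ ∧ᶜ φ₂) (B₁ ∧B B₂)
Represents-∧ {φ₁} {φ₂} {B₁} {B₂} r₁ r₂ a = eval≡false⇔fpath a (B₁ ∧B B₂) ⇔-∘ unsat⇔eval
  where
  both : (¬ (CNFSat a φ₁ × CNFSat a φ₂)) ⇔ eval a B₁ ∧ eval a B₂ ≡ false
  both = ¬×⇔∧≡false (Represents⇔eval {B = B₁} r₁ a) (Represents⇔eval {B = B₂} r₂ a)
  unsat⇔eval : (¬ CNFSat a (φ₁ ∧ᶜ φ₂)) ⇔ eval a (B₁ ∧B B₂) ≡ false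
  unsat⇔eval = mk⇔
    (λ ¬s → trans (eval-∧B a B₁ B₂) (Equivalence.to both λ (s₁ , s₂) → ¬s (++⁺ s₁ s₂)))
    (λ e s → Equivalence.from both (trans (sym (eval-∧B a B₁ B₂)) e) (++⁻ˡ φ₁ s , ++⁻ʳ φ₁ s))

_≟ₗ_ : DecidableEquality Lit
_≟ₗ_ = ≡-dec Data.Nat._≟_ Data.Bool._≟_

open import Data.List.Relation.Binary.Subset.DecPropositional _≟ₗ_ using (_⊆?_)

record Covers (B : BDD) (α : Path) : Set where
  constructor covered
  field
    {path}   : Path
    path∈    : path ∈ fpaths B
    path⊆α   : path ⊆ α

covers-self : ∀ {B α} → α ∈ fpaths B → Covers B α
covers-self α∈ = covered α∈ ⊆-refl

covers-∷ : ∀ {B α} lit → Covers B α → Covers B (lit ∷ α)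
covers-∷ {α = α} lit (covered β∈ β⊆α) = covered β∈ (⊆-trans β⊆α (xs⊆x∷xs α lit))

covers-high : ∀ {x h l α} → Covers h α → Covers (node x h l) ((x , true) ∷ α)
covers-high {x} {h} {l} (covered β∈ β⊆α) = covered (fpaths-high h l β∈) (∷⁺ʳ (x , true) β⊆α)

covers-low : ∀ {x h l α} → Covers l α → Covers (node x h l) ((x , false) ∷ α)
covers-low {x} {h} {l} (covered β∈ β⊆α) = covered (fpaths-low h l β∈) (∷⁺ʳ (x , false) β⊆α)

∧B-covers : ∀ B₁ B₂ {α} → α ∈ fpaths (B₁ ∧B B₂) → Covers B₁ α ⊎ Covers B₂ α
conjR-covers : ∀ x h l B {α} → α ∈ fpaths (conjR x h l B) → Covers (node x h l) α ⊎ Covers B α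

∧B-covers (leaf false) B₂ α∈ = inj₁ (covers-self α∈)
∧B-covers (leaf true) B₂ α∈ = inj₂ (covers-self α∈)
∧B-covers (node x h l) B₂ α∈ = conjR-covers x h l B₂ α∈

conjR-covers x h l (leaf false) α∈ = inj₂ (covers-self α∈)
conjR-covers x h l (leaf true) α∈ = inj₁ (covers-self α∈)
conjR-covers x h l B@(node y h₂ l₂) α∈ with cmpV x y | cmpView x y
... | lt | less _ with fpaths-node⁻ x (h ∧B B) (l ∧B B) α∈
...   | high α′∈ = Sum.map covers-high (covers-∷ _) (∧B-covers h B α′∈)
...   | low α′∈ = Sum.map covers-low (covers-∷ _) (∧B-covers l B α′∈)
conjR-covers x h l (node y h₂ l₂) α∈ | eq | equal refl with fpaths-node⁻ x (h ∧B h₂) (l ∧B l₂) α∈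
...   | high α′∈ = Sum.map covers-high covers-high (∧B-covers h h₂ α′∈)
...   | low α′∈ = Sum.map covers-low covers-low (∧B-covers l l₂ α′∈)
conjR-covers x h l (node y h₂ l₂) α∈ | gt | greater _
  with fpaths-node⁻ y (conjR x h l h₂) (conjR x h l l₂) α∈
...   | high α′∈ = Sum.map (covers-∷ _) covers-high (conjR-covers x h l h₂ α′∈)
...   | low α′∈ = Sum.map (covers-∷ _) covers-low (conjR-covers x h l l₂ α′∈)

fpathsVia⊆fpaths : ∀ q B → fpathsVia q B ⊆ fpaths B
fpathsVia⊆fpaths q B with B ≟B q
fpathsVia⊆fpaths q B | yes _ = ⊆-refl
fpathsVia⊆fpaths q (node x h l) | no _ =
  Subset.++⁺ (Subset.map⁺ _ (fpathsVia⊆fpaths q h)) (Subset.map⁺ _ (fpathsVia⊆fpaths q l))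

fpathsVia-self : ∀ B → fpathsVia B B ≡ fpaths B
fpathsVia-self B with B ≟B B
... | yes _ = refl
... | no B≢B = ⊥-elim (B≢B refl)

open Multiplicity _≟C_

excess≡#ClsAt : ∀ F B q → excess F B q ≡ length (ClsAt F B q)
excess≡#ClsAt F B q = length∸surplus≡#distinct F (fpathsVia q B)

#distinct≤ : ∀ {F B k} → B ≢ leaf false → (∀ q → q ⊑ B → IsInner q → excess F B q ≤ k) →
             length (distinct F (fpaths B)) ≤ k
#distinct≤ {B = leaf false} B≢false _ = ⊥-elim (B≢false refl)
#distinct≤ {B = leaf true} _ _ = z≤n
#distinct≤ {F} {B = B@(node _ _ _)} {k} _ bound = subst (_≤ k) root-excess (bound B here tt)
  where
  root-excess : excess F B B ≡ length (distinct F (fpaths B))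
  root-excess = trans (excess≡#ClsAt F B B) (cong (λ ps → length (distinct F ps)) (fpathsVia-self B))

∧B-zeroʳ : ∀ B → B ∧B leaf false ≡ leaf false
∧B-zeroʳ (leaf false) = refl
∧B-zeroʳ (leaf true) = refl
∧B-zeroʳ (node _ _ _) = refl

⊑leaf⇒¬IsInner : ∀ {q b} → q ⊑ leaf b → ¬ IsInner q
⊑leaf⇒¬IsInner here ()

inner⊑∧B⇒¬false : ∀ {q} B₁ B₂ → q ⊑ (B₁ ∧B B₂) → IsInner q → B₁ ≢ leaf false × B₂ ≢ leaf false
inner⊑∧B⇒¬false {q} B₁ B₂ q⊑ inner =
  (λ { refl → ⊑leaf⇒¬IsInner q⊑ inner }) ,
  (λ { refl → ⊑leaf⇒¬IsInner (subst (q ⊑_) (∧B-zeroʳ B₁) q⊑) inner })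

covers? : ∀ B α → Dec (Covers B α)
covers? B α = map′ (λ c → let _ , β∈ , β⊆α = find {P = _⊆ α} c in covered β∈ β⊆α)
                   (λ (covered β∈ β⊆α) → lose {P = _⊆ α} β∈ β⊆α)
                   (any? (_⊆? α) (fpaths B))

_⊭-weaken_ : ∀ {α β C} → β ⊆ α → β ⊭ C → α ⊭ C
(β⊆α ⊭-weaken β⊭C) a α-sat = β⊭C a (All-resp-⊇ β⊆α α-sat)

record InheritedFrom (B : BDD) (F : Path → Clause) (α : Path) (C : Clause) : Set where
  constructor inherited
  field
    covering : Covers B α
    clause≡  : F (Covers.path covering) ≡ C

inherited-valid : ∀ {φ B F α C} → ValidF φ B F → InheritedFrom B F α C → C ∈ φ × α ⊭ C
inherited-valid valid (inherited (covered β∈ β⊆α) refl) =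
  let F[β]∈φ , β⊭F[β] = valid _ β∈ in F[β]∈φ , β⊆α ⊭-weaken β⊭F[β]

inherited-∈ : ∀ {B F α C} → InheritedFrom B F α C → C ∈ distinct F (fpaths B)
inherited-∈ {F = F} (inherited (covered β∈ _) refl) = ∈-deduplicate⁺ _≟C_ (∈-map⁺ F β∈)

module Conjunction (B₁ B₂ : BDD) (F₁ F₂ : Path → Clause) where

  F : Path → Clause
  F α with covers? B₁ α | covers? B₂ α
  ... | yes c | _     = F₁ (Covers.path c)
  ... | no _  | yes c = F₂ (Covers.path c)
  ... | no _  | no _  = []

  F-inherited : ∀ {α} → α ∈ fpaths (B₁ ∧B B₂) → InheritedFrom B₁ F₁ α (F α) ⊎ InheritedFrom B₂ F₂ α (F α)
  F-inherited {α} α∈ with covers? B₁ α | covers? B₂ α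
  ... | yes c | _     = inj₁ (inherited c refl)
  ... | no _  | yes c = inj₂ (inherited c refl)
  ... | no ¬c₁ | no ¬c₂ = ⊥-elim ([ ¬c₁ , ¬c₂ ] (∧B-covers B₁ B₂ α∈))

  F-valid : ∀ {φ₁ φ₂} → ValidF φ₁ B₁ F₁ → ValidF φ₂ B₂ F₂ → ValidF (φ₁ ∧ᶜ φ₂) (B₁ ∧B B₂) F
  F-valid {φ₁} valid₁ valid₂ α α∈ with F-inherited α∈
  ... | inj₁ inh = Product.map₁ ∈-++⁺ˡ (inherited-valid valid₁ inh)
  ... | inj₂ inh = Product.map₁ (∈-++⁺ʳ φ₁) (inherited-valid valid₂ inh)

  ClsAt⊆ : ∀ q → ClsAt F (B₁ ∧B B₂) q ⊆ distinct F₁ (fpaths B₁) ++ distinct F₂ (fpaths B₂)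
  ClsAt⊆ q C∈ with ∈-map⁻ F (∈-deduplicate⁻ _≟C_ _ C∈)
  ... | α , α∈ , refl with F-inherited (fpathsVia⊆fpaths q (B₁ ∧B B₂) α∈)
  ...   | inj₁ inh = ∈-++⁺ˡ (inherited-∈ inh)
  ...   | inj₂ inh = ∈-++⁺ʳ (distinct F₁ (fpaths B₁)) (inherited-∈ inh)

  excess≤ : ∀ q → excess F (B₁ ∧B B₂) q ≤ length (distinct F₁ (fpaths B₁)) + length (distinct F₂ (fpaths B₂))
  excess≤ q = begin
    excess F (B₁ ∧B B₂) q                                    ≡⟨ excess≡#ClsAt F (B₁ ∧B B₂) q ⟩
    length (ClsAt F (B₁ ∧B B₂) q)                            ≤⟨ Unique∧⊆⇒length≤ (deduplicate-! _≟C_ _) (ClsAt⊆ q) ⟩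
    length (distinct F₁ (fpaths B₁) ++ distinct F₂ (fpaths B₂)) ≡⟨ List.length-++ (distinct F₁ (fpaths B₁)) ⟩
    length (distinct F₁ (fpaths B₁)) + length (distinct F₂ (fpaths B₂)) ∎
    where open ≤-Reasoning

lemma9 : (φ₁ φ₂ : CNF) (B₁ B₂ : BDD) (F₁ F₂ : Path → Clause) (k₁ k₂ : ℕ) →
    Ordered B₁ → Ordered B₂ →
    Represents φ₁ B₁ → ValidF φ₁ B₁ F₁ →
    Represents φ₂ B₂ → ValidF φ₂ B₂ F₂ →
    (∀ q₁ → q₁ ⊑ B₁ → IsInner q₁ → excess F₁ B₁ q₁ ≤ k₁) →
    (∀ q₂ → q₂ ⊑ B₂ → IsInner q₂ → excess F₂ B₂ q₂ ≤ k₂) →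
    Ordered (B₁ ∧B B₂) × Represents (φ₁ ∧ᶜ φ₂) (B₁ ∧B B₂) ×
    Σ (Path → Clause) (λ F → ValidF (φ₁ ∧ᶜ φ₂) (B₁ ∧B B₂) F ×
      (∀ q → q ⊑ (B₁ ∧B B₂) → IsInner q → excess F (B₁ ∧B B₂) q ≤ k₁ + k₂))
lemma9 φ₁ φ₂ B₁ B₂ F₁ F₂ k₁ k₂ o₁ o₂ r₁ v₁ r₂ v₂ bound₁ bound₂ =
  ∧B-ordered B₁ B₂ o₁ o₂ , Represents-∧ {B₁ = B₁} {B₂ = B₂} r₁ r₂ , F , F-valid v₁ v₂ , bound
  where
  open Conjunction B₁ B₂ F₁ F₂
  bound : ∀ q → q ⊑ (B₁ ∧B B₂) → IsInner q → excess F (B₁ ∧B B₂) q ≤ k₁ + k₂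
  bound q q⊑ inner =
    let B₁≢false , B₂≢false = inner⊑∧B⇒¬false B₁ B₂ q⊑ inner
    in ≤-trans (excess≤ q) (+-mono-≤ (#distinct≤ B₁≢false bound₁) (#distinct≤ B₂≢false bound₂))
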